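{- Let $\mathcal{F}\colon\mathsf{X}\to\mathsf{Y}$ be a non-trivial left adjoint functor between generalized quasi-varieties. Choose a cardinal $\kappa>0$ and a surjective homomorphism $\pi_1\colon\mathbf{Tm}_{\mathsf{Y}}(\kappa)\to\mathcal{F}(\mathbf{Tm}_{\mathsf{X}}(1))$ (with free generators $\{x^i:i<\kappa\}$), and let $\Theta\subseteq Eq(\mathscr{L}_{\mathsf{Y}},\kappa)$ be its kernel, viewed as a set of equations in the variables $x^i$. For each cardinal $n$, let $\pi_n\colon\mathbf{Tm}_{\mathsf{Y}}(\kappa\times n)\to\mathcal{F}(\mathbf{Tm}_{\mathsf{X}}(n))$ (free generators $\{x^i_j:i<\kappa,j<n\}$) be the homomorphism sending $x^i_j$ to $\mathcal{F}(\iota_j)(\pi_1(x^i))$, where $\iota_j\colon\mathbf{Tm}_{\mathsf{X}}(1)\to\mathbf{Tm}_{\mathsf{X}}(n)$ sends the generator $x$ to $x_j$. For each $n$-ary basic symbol $\psi\in\mathscr{L}_{\mathsf{X}}$, choose a homomorphism $\boldsymbol\tau(\psi)\colon\mathbf{Tm}_{\mathsf{Y}}(\kappa)\to\mathbf{Tm}_{\mathsf{Y}}(\kappa\times n)$ with $\pi_n\circ\boldsymbol\tau(\psi)=\mathcal{F}(\psi)\circ\pi_1$, where $\psi\colon\mathbf{Tm}_{\mathsf{X}}(1)\to\mathbf{Tm}_{\mathsf{X}}(n)$ denotes the homomorphism sending $x$ to $\psi(x_1,\dots,x_n)$, and identify $\boldsymbol\tau(\psi)$ with the $\kappa$-sequence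 $\langle\boldsymbol\tau(\psi)(x^i):i<\kappa\rangle$ of terms (representatives) in the variables $\{x^i_j:i<\kappa,1\le j\le n\}$. Then $\langle\boldsymbol\tau,\Theta\rangle$ is a non-trivial contextual $\kappa$-translation of $\vDash_{\mathsf{X}}$ into $\vDash_{\mathsf{Y}}$.
   Context: Generalized quasi-varieties: classes axiomatized by a set of generalized quasi-equations $(\bigwedge_{i\in I}\alpha_i\approx\beta_i)\to\varphi\approx\psi$ ($I$ possibly infinite) with number of variables bounded by an infinite cardinal; viewed as categories with homomorphisms (including the empty algebra if the language has no constants). $\mathbf{Tm}_{\mathsf{K}}(\mu)$ is the free algebra of $\mathsf{K}$ on $\mu$ generators. A left adjoint functor is trivial if it sends everything to the initial object. $\Phi\vDash_{\mathsf{K}}\epsilon\approx\delta$ means every assignment into a member of $\mathsf{K}$ satisfying all equations of $\Phi$ satisfies $\epsilon\approx\delta$. $\mathscr{L}^{\kappa}_{\mathsf{Y}}$ is the language whose $n$-ary symbols are the $\kappa$-sequences of $\mathscr{L}_{\mathsf{Y}}$-terms in variables $\{x^j_m:1\le m\le n,j<\kappa\}$. A $\kappa$-translation $\boldsymbol\tau$ of $\mathscr{L}_{\mathsf{X}}$ into $\mathscr{L}_{\mathsf{Y}}$ is an arity-preserving map $\mathscr{L}_{\mathsf{X}}\to\mathscr{L}^{\kappa}_{\mathsf{Y}}$. For a cardinal $\lambda$ it extends to $\boldsymbol\tau_*\colon Tm(\mathscr{L}_{\mathsf{X}},\lambda)\to Tm(\mathscr{L}_{\mathsf{Y}},\kappa\times\lambda)^\kappa$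 by $\boldsymbol\tau_*(x_j)=\langle x^i_j:i<\kappa\rangle$, $\boldsymbol\tau_*(c)=\boldsymbol\tau(c)$, and, if $\boldsymbol\tau(\psi)=\langle t_i:i<\kappa\rangle$, $\boldsymbol\tau_*(\psi(\varphi_1,\dots,\varphi_n))(i)=t_i(\boldsymbol\tau_*(\varphi_1)/\vec x_1,\dots,\boldsymbol\tau_*(\varphi_n)/\vec x_n)$; and $\boldsymbol\tau^*(\Phi)=\{\boldsymbol\tau_*(\epsilon)(i)\approx\boldsymbol\tau_*(\delta)(i):i<\kappa,\epsilon\approx\delta\in\Phi\}$. A contextual $\kappa$-translation of $\vDash_{\mathsf{X}}$ into $\vDash_{\mathsf{Y}}$ is a pair $\langle\boldsymbol\tau,\Theta\rangle$, $\boldsymbol\tau$ a $\kappa$-translation and $\Theta\subseteq Eq(\mathscr{L}_{\mathsf{Y}},\kappa)$ in variables $\{x^i:i<\kappa\}$, such that (1) for every cardinal $\lambda$ and $\Phi\cup\{\epsilon\approx\delta\}\subseteq Eq(\mathscr{L}_{\mathsf{X}},\lambda)$, $\Phi\vDash_{\mathsf{X}}\epsilon\approx\delta$ implies $\boldsymbol\tau^*(\Phi)\cup\bigcup_{j<\lambda}\Theta(\vec x_j)\vDash_{\mathsf{Y}}\boldsymbol\tau^*(\epsilon\approx\delta)$, and (2) for every $n$-ary $\psi\in\mathscr{L}_{\mathsf{X}}$, $\Theta(\vec x_1)\cup\dots\cup\Theta(\vec x_n)\vDash_{\mathsf{Y}}\Theta(\boldsymbol\tau_*\psi(x_1,\dots,x_n))$,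 with $\vec x_j=\langle x^i_j:i<\kappa\rangle$. It is non-trivial if, whenever some $\kappa$-sequence $\vec\varphi$ of closed $\mathscr{L}_{\mathsf{Y}}$-terms satisfies $\mathsf{Y}\vDash\Theta(\vec\varphi)$, there are $i_0<\kappa$ and variable sequences $\vec x,\vec y$ with $\Theta(\vec x)\cup\Theta(\vec y)\nvDash_{\mathsf{Y}}x^{i_0}\approx y^{i_0}$. -}

module Defs where

open import Level using (Level; 0ℓ) renaming (suc to lsuc)
open import Data.Nat using (ℕ)
open import Data.Fin using (Fin)
open import Data.Product using (Σ; Σ-syntax; _×_; _,_; proj₁; proj₂)
open import Data.Sum using (_⊎_; inj₁; inj₂)
open import Data.Unit using (⊤; tt)
open import Data.Empty using (⊥)
open import Relation.Nullary using (¬_)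
open import Relation.Binary.Structures using (IsEquivalence)

record Signature : Set₁ where
  field
    Op    : Set
    arity : Op → ℕ
open Signature public

data Term (L : Signature) (V : Set) : Set where
  var : V → Term L V
  op  : (f : Op L) → (Fin (arity L f) → Term L V) → Term L V

_[_] : ∀ {L V W} → Term L V → (V → Term L W) → Term L W
var v   [ σ ] = σ v
op f ts [ σ ] = op f (λ k → ts k [ σ ])

rename : ∀ {L V W} → (V → W) → Term L V → Term L W
rename r t = t [ (λ v → var (r v)) ]

record Eqn (L : Signature) (V : Set) : Set where
  constructor _≐_
  field
    lhs : Term L V
    rhs : Term L V
open Eqn public

substEqn : ∀ {L V W} → Eqn L V → (V → Term L W) → Eqn L W
substEqn (s ≐ t) σ = (s [ σ ]) ≐ (t [ σ ])

record EqSet (L : Signature) (V : Set) : Set₁ where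
  field
    Idx : Set
    eqn : Idx → Eqn L V
open EqSet public

∅ₑ : ∀ {L V} → EqSet L V
∅ₑ = record { Idx = ⊥ ; eqn = λ () }

_∪ₑ_ : ∀ {L V} → EqSet L V → EqSet L V → EqSet L V
Φ ∪ₑ Ψ = record { Idx = Idx Φ ⊎ Idx Ψ
                ; eqn = λ { (inj₁ k) → eqn Φ k ; (inj₂ k) → eqn Ψ k } }

⋃ₑ : ∀ {L V} (J : Set) → (J → EqSet L V) → EqSet L V
⋃ₑ J Φ = record { Idx = Σ[ j ∈ J ] Idx (Φ j) ; eqn = λ { (j , k) → eqn (Φ j) k } }

_⟨_⟩ₑ : ∀ {L V W} → EqSet L V → (V → Term L W) → EqSet L W
Θ ⟨ σ ⟩ₑ = record { Idx = Idx Θ ; eqn = λ k → substEqn (eqn Θ k) σ }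

-- Algebras (carriers are setoids; the empty algebra is allowed)

record Algebra (L : Signature) : Set₁ where
  field
    Carrier       : Set
    _≈_           : Carrier → Carrier → Set
    isEquivalence : IsEquivalence _≈_
    ⟦_⟧           : (f : Op L) → (Fin (arity L f) → Carrier) → Carrier
    ⟦⟧-cong       : ∀ f {as bs} → (∀ k → as k ≈ bs k) → ⟦ f ⟧ as ≈ ⟦ f ⟧ bs
open Algebra public

eval : ∀ {L V} (A : Algebra L) → (V → Carrier A) → Term L V → Carrier A
eval A g (var v)   = g v
eval A g (op f ts) = ⟦ A ⟧ f (λ k → eval A g (ts k))

Sat : ∀ {L V} (A : Algebra L) → (V → Carrier A) → Eqn L V → Set
Sat A g (s ≐ t) = _≈_ A (eval A g s) (eval A g t)

record GQE (L : Signature) : Set₁ where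
  field
    Var        : Set
    Prem       : Set
    premise    : Prem → Eqn L Var
    conclusion : Eqn L Var
open GQE public

record GQV : Set₁ where
  field
    lang  : Signature
    Ax    : Set
    axiom : Ax → GQE lang
open GQV public

IsModel : (K : GQV) → Algebra (lang K) → Set
IsModel K A = ∀ a (g : Var (axiom K a) → Carrier A)
            → (∀ p → Sat A g (premise (axiom K a) p))
            → Sat A g (conclusion (axiom K a))

record Model (K : GQV) : Set₁ where
  constructor mod
  field
    alg : Algebra (lang K)
    sat : IsModel K alg
open Model public

Ent : ∀ {V} (K : GQV) → EqSet (lang K) V → Eqn (lang K) V → Set₁
Ent {V} K Φ e =
  ∀ (A : Model K) (g : V → Carrier (alg A)) → (∀ k → Sat (alg A) g (eqn Φ k)) → Sat (alg A) g e

Entₛ : ∀ {V} (K : GQV) → EqSet (lang K) V → EqSet (lang K) V → Set₁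
Entₛ K Φ Ψ = ∀ k → Ent K Φ (eqn Ψ k)

record Hom {L} (A B : Algebra L) : Set where
  field
    fun  : Carrier A → Carrier B
    cong : ∀ {a b} → _≈_ A a b → _≈_ B (fun a) (fun b)
    hom  : ∀ f as → _≈_ B (fun (⟦ A ⟧ f as)) (⟦ B ⟧ f (λ k → fun (as k)))
open Hom public

_≗ₕ_ : ∀ {L} {A B : Algebra L} → Hom A B → Hom A B → Set
_≗ₕ_ {B = B} h h' = ∀ a → _≈_ B (fun h a) (fun h' a)

idₕ : ∀ {L} {A : Algebra L} → Hom A A
idₕ {A = A} = record { fun = λ a → a ; cong = λ e → e
                     ; hom = λ f as → IsEquivalence.refl (isEquivalence A) }

_∘ₕ_ : ∀ {L} {A B C : Algebra L} → Hom B C → Hom A B → Hom A C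
_∘ₕ_ {C = C} g h = record
  { fun  = λ a → fun g (fun h a)
  ; cong = λ e → cong g (cong h e)
  ; hom  = λ f as → IsEquivalence.trans (isEquivalence C) (cong g (hom h f as)) (hom g f (λ k → fun h (as k))) }

HomM : ∀ {K} → Model K → Model K → Set
HomM A B = Hom (alg A) (alg B)

record Functor (X Y : GQV) : Set₁ where
  field
    F₀     : Model X → Model Y
    F₁     : ∀ {A B} → HomM A B → HomM (F₀ A) (F₀ B)
    F-cong : ∀ {A B} {f g : HomM A B} → f ≗ₕ g → F₁ {A} {B} f ≗ₕ F₁ {A} {B} g
    F-id   : ∀ {A} → F₁ {A} {A} (idₕ {A = alg A}) ≗ₕ idₕ
    F-∘    : ∀ {A B C} (g : HomM B C) (f : HomM A B) →
             F₁ {A} {C} (g ∘ₕ f) ≗ₕ (F₁ {B} {C} g ∘ₕ F₁ {A} {B} f)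
open Functor public

record LeftAdjoint {X Y : GQV} (F : Functor X Y) : Set₁ where
  field
    G          : Functor Y X
    η          : ∀ A → HomM A (F₀ G (F₀ F A))
    η-natural  : ∀ {A B} (f : HomM A B) → (F₁ G (F₁ F f) ∘ₕ η A) ≗ₕ (η B ∘ₕ f)
    universal  : ∀ A B (f : HomM A (F₀ G B)) →
                 Σ[ g ∈ HomM (F₀ F A) B ]
                   (((F₁ G g ∘ₕ η A) ≗ₕ f) ×
                    (∀ (g' : HomM (F₀ F A) B) → (F₁ G g' ∘ₕ η A) ≗ₕ f → g' ≗ₕ g))

IsInitial : ∀ {K} → Model K → Set₁
IsInitial {K} I = ∀ (B : Model K) → Σ[ h ∈ HomM I B ] (∀ h' → h' ≗ₕ h)

Trivial : ∀ {X Y} → Functor X Y → Set₁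
Trivial {X} F = ∀ (A : Model X) → IsInitial (F₀ F A)

NonTrivial : ∀ {X Y} → Functor X Y → Set₁
NonTrivial F = ¬ Trivial F

-- Free algebras  Tm_K(V): terms modulo K-derivable equality
-- (the least congruence closed under all substitution instances of the axioms)

data Deriv (K : GQV) {V : Set} : Term (lang K) V → Term (lang K) V → Set where
  d-refl  : ∀ {t} → Deriv K t t
  d-sym   : ∀ {s t} → Deriv K s t → Deriv K t s
  d-trans : ∀ {s t u} → Deriv K s t → Deriv K t u → Deriv K s u
  d-cong  : ∀ f {as bs} → (∀ k → Deriv K (as k) (bs k)) → Deriv K (op f as) (op f bs)
  d-ax    : ∀ a (h : Var (axiom K a) → Term (lang K) V)
            → (∀ p → Deriv K (lhs (premise (axiom K a) p) [ h ]) (rhs (premise (axiom K a) p) [ h ]))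
            → Deriv K (lhs (conclusion (axiom K a)) [ h ]) (rhs (conclusion (axiom K a)) [ h ])

FreeAlg : (K : GQV) → Set → Algebra (lang K)
FreeAlg K V = record
  { Carrier = Term (lang K) V
  ; _≈_ = Deriv K
  ; isEquivalence = record { refl = d-refl ; sym = d-sym ; trans = d-trans }
  ; ⟦_⟧ = op
  ; ⟦⟧-cong = d-cong }

eval-free : ∀ K {V W} (g : V → Term (lang K) W) t → Deriv K (eval (FreeAlg K W) g t) (t [ g ])
eval-free K g (var v)   = d-refl
eval-free K g (op f ts) = d-cong f (λ k → eval-free K g (ts k))

free-isModel : ∀ K V → IsModel K (FreeAlg K V)
free-isModel K V a g prem =
  d-trans (eval-free K g (lhs C))
    (d-trans (d-ax a g (λ p → d-trans (d-sym (eval-free K g (lhs (P p))))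
                               (d-trans (prem p) (eval-free K g (rhs (P p))))))
      (d-sym (eval-free K g (rhs C))))
  where
    C = conclusion (axiom K a)
    P = premise (axiom K a)

Tm : (K : GQV) → Set → Model K
Tm K V = mod (FreeAlg K V) (free-isModel K V)

subst-comp : ∀ K {U V W} (h : U → Term (lang K) V) (σ : V → Term (lang K) W) t
           → Deriv K ((t [ h ]) [ σ ]) (t [ (λ u → h u [ σ ]) ])
subst-comp K h σ (var u)   = d-refl
subst-comp K h σ (op f ts) = d-cong f (λ k → subst-comp K h σ (ts k))

subst-deriv : ∀ K {V W} (σ : V → Term (lang K) W) {s t} → Deriv K s t → Deriv K (s [ σ ]) (t [ σ ])
subst-deriv K σ d-refl          = d-refl
subst-deriv K σ (d-sym d)       = d-sym (subst-deriv K σ d)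
subst-deriv K σ (d-trans d e)   = d-trans (subst-deriv K σ d) (subst-deriv K σ e)
subst-deriv K σ (d-cong f ds)   = d-cong f (λ k → subst-deriv K σ (ds k))
subst-deriv K σ (d-ax a h ds)   =
  d-trans (subst-comp K h σ (lhs C))
    (d-trans (d-ax a (λ u → h u [ σ ])
               (λ p → d-trans (d-sym (subst-comp K h σ (lhs (P p))))
                        (d-trans (subst-deriv K σ (ds p)) (subst-comp K h σ (rhs (P p))))))
      (d-sym (subst-comp K h σ (rhs C))))
  where
    C = conclusion (axiom K a)
    P = premise (axiom K a)

substHom : ∀ K {V W} → (V → Term (lang K) W) → HomM (Tm K V) (Tm K W)
substHom K σ = record { fun = λ t → t [ σ ] ; cong = subst-deriv K σ ; hom = λ f as → d-refl }

ιHom : ∀ K {N : Set} → N → HomM (Tm K ⊤) (Tm K N)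
ιHom K j = substHom K (λ _ → var j)

opHom : ∀ K (ψ : Op (lang K)) → HomM (Tm K ⊤) (Tm K (Fin (arity (lang K) ψ)))
opHom K ψ = substHom K (λ _ → op ψ var)

record Translation (X Y : GQV) (κ : Set) : Set where
  constructor translation
  field
    tr : (ψ : Op (lang X)) → κ → Term (lang Y) (κ × Fin (arity (lang X) ψ))
open Translation public

τ₊ : ∀ {X Y κ μ} → Translation X Y κ → Term (lang X) μ → κ → Term (lang Y) (κ × μ)
τ₊ τ (var j)    i = var (i , j)
τ₊ τ (op ψ ts)  i = tr τ ψ i [ (λ { (i' , m) → τ₊ τ (ts m) i' }) ]

τ*₁ : ∀ {X Y κ μ} → Translation X Y κ → Eqn (lang X) μ → EqSet (lang Y) (κ × μ)
τ*₁ {κ = κ} τ (ε ≐ δ) = record { Idx = κ ; eqn = λ i → τ₊ τ ε i ≐ τ₊ τ δ i }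

τ* : ∀ {X Y κ μ} → Translation X Y κ → EqSet (lang X) μ → EqSet (lang Y) (κ × μ)
τ* {κ = κ} τ Φ = ⋃ₑ (Idx Φ) (λ k → τ*₁ τ (eqn Φ k))

Θat : ∀ {L κ μ} → EqSet L κ → μ → EqSet L (κ × μ)
Θat Θ j = Θ ⟨ (λ i → var (i , j)) ⟩ₑ

record ContextualTranslation (X Y : GQV) (κ : Set)
                             (τ : Translation X Y κ) (Θ : EqSet (lang Y) κ) : Set₁ where
  field
    preserves : ∀ (μ : Set) (Φ : EqSet (lang X) μ) (e : Eqn (lang X) μ)
              → Ent X Φ e
              → Entₛ Y (τ* τ Φ ∪ₑ ⋃ₑ μ (Θat Θ)) (τ*₁ τ e)
    closed    : ∀ (ψ : Op (lang X))
              → Entₛ Y (⋃ₑ (Fin (arity (lang X) ψ)) (Θat Θ))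
                       (Θ ⟨ τ₊ τ (op ψ var) ⟩ₑ)

NonTrivialCT : (Y : GQV) (κ : Set) → EqSet (lang Y) κ → Set₁
NonTrivialCT Y κ Θ =
  ∀ (φ : κ → Term (lang Y) ⊥)
  → Entₛ Y ∅ₑ (Θ ⟨ φ ⟩ₑ)
  → Σ[ i₀ ∈ κ ] ¬ Ent Y ((Θ ⟨ (λ i → var (inj₁ i)) ⟩ₑ) ∪ₑ (Θ ⟨ (λ i → var (inj₂ i)) ⟩ₑ))
                       (var (inj₁ i₀) ≐ var (inj₂ i₀))

kernel : ∀ {Y : GQV} {κ : Set} {B : Model Y} → HomM (Tm Y κ) B → EqSet (lang Y) κ
kernel {Y} {κ} {B} π = record
  { Idx = Σ[ e ∈ Eqn (lang Y) κ ] _≈_ (alg B) (fun π (lhs e)) (fun π (rhs e))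
  ; eqn = proj₁ }

πₙ : ∀ {X Y : GQV} (F : Functor X Y) {κ : Set} (π₁ : HomM (Tm Y κ) (F₀ F (Tm X ⊤)))
     (N : Set) → Term (lang Y) (κ × N) → Carrier (alg (F₀ F (Tm X N)))
πₙ {X} F π₁ N = eval (alg (F₀ F (Tm X N)))
                     (λ { (i , j) → fun (F₁ F (ιHom X j)) (fun π₁ (var i)) })

-- Θ presents P = F(Tm_X(1)) as a quotient of Tm_Y(κ), so homomorphisms P → A are the
-- κ-tuples of A satisfying Θ. As a left adjoint, F preserves coproducts, and F(Tm_X(μ))
-- is the μ-th copower of P; hence an assignment g satisfying Θ on every column j gives
-- H : F(Tm_X(μ)) → A with H ∘ π_μ = eval g. Under H the translation τ_*(t) evaluates to
-- H ∘ F(t̂) ∘ π₁, and H ∘ F(ŝ) = H ∘ F(t̂) holds exactly when the transposed assignment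
-- into G(A) satisfies s ≈ t; this carries entailments of X over to Y.
-- If Θ(x) ∪ Θ(y) forced every x^i ≈ y^i, any two homomorphisms out of P would agree,
-- and a closed solution of Θ yields one into every algebra: P would be initial, and
-- then, by adjointness, so would every F(A).
module Submission where

open import Defs
open import Level using (0ℓ) renaming (suc to lsuc)
open import Axiom.ExcludedMiddle using (ExcludedMiddle)
open import Axiom.DoubleNegationElimination using (em⇒dne)
open import Data.Fin using (Fin)
open import Data.Unit using (⊤; tt)
open import Data.Product using (Σ-syntax; ∃; _×_; _,_; proj₁; proj₂)
open import Data.Sum using (_⊎_; inj₁; inj₂)
open import Data.Empty using (⊥)
open import Relation.Nullary using (¬_)
open import Relation.Nullary.Negation using (¬∃⟶∀¬)
open import Relation.Binary.Bundles using (Setoid)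
open import Relation.Binary.Structures using (IsEquivalence)
import Relation.Binary.Reasoning.Setoid as SetoidReasoning

module _ {L : Signature} (A : Algebra L) where

  setoid : Setoid 0ℓ 0ℓ
  setoid = record { Carrier = Carrier A ; _≈_ = _≈_ A ; isEquivalence = isEquivalence A }

  ≈-refl : ∀ {a} → _≈_ A a a
  ≈-refl = IsEquivalence.refl (isEquivalence A)

  ≈-sym : ∀ {a b} → _≈_ A a b → _≈_ A b a
  ≈-sym = IsEquivalence.sym (isEquivalence A)

  ≈-trans : ∀ {a b c} → _≈_ A a b → _≈_ A b c → _≈_ A a c
  ≈-trans = IsEquivalence.trans (isEquivalence A)

  eval-cong : ∀ {V} {ρ ρ' : V → Carrier A} → (∀ v → _≈_ A (ρ v) (ρ' v))
            → ∀ t → _≈_ A (eval A ρ t) (eval A ρ' t)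
  eval-cong e (var v)   = e v
  eval-cong e (op f ts) = ⟦⟧-cong A f (λ k → eval-cong e (ts k))

  eval-subst : ∀ {V W} (ρ : W → Carrier A) (σ : V → Term L W) t
             → _≈_ A (eval A ρ (t [ σ ])) (eval A (λ v → eval A ρ (σ v)) t)
  eval-subst ρ σ (var v)   = ≈-refl
  eval-subst ρ σ (op f ts) = ⟦⟧-cong A f (λ k → eval-subst ρ σ (ts k))

hom-eval : ∀ {L V} {A B : Algebra L} (h : Hom A B) (ρ : V → Carrier A) t
         → _≈_ B (fun h (eval A ρ t)) (eval B (λ v → fun h (ρ v)) t)
hom-eval {B = B} h ρ (var v)   = ≈-refl B
hom-eval {A = A} {B} h ρ (op f ts) =
  ≈-trans B (hom h f (λ k → eval A ρ (ts k))) (⟦⟧-cong B f (λ k → hom-eval h ρ (ts k)))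

free-hom-eval : ∀ {K V} {B : Algebra (lang K)} (h : Hom (FreeAlg K V) B) t
              → _≈_ B (fun h t) (eval B (λ v → fun h (var v)) t)
free-hom-eval {B = B} h (var v)   = ≈-refl B
free-hom-eval {B = B} h (op f ts) =
  ≈-trans B (hom h f ts) (⟦⟧-cong B f (λ k → free-hom-eval h (ts k)))

free-hom-ext : ∀ {K V} {B : Algebra (lang K)} (h h' : Hom (FreeAlg K V) B)
             → (∀ v → _≈_ B (fun h (var v)) (fun h' (var v))) → h ≗ₕ h'
free-hom-ext {B = B} h h' e t =
  ≈-trans B (free-hom-eval h t) (≈-trans B (eval-cong B e t) (≈-sym B (free-hom-eval h' t)))

Deriv-sound : ∀ K {V} (A : Model K) (ρ : V → Carrier (alg A)) {s t} → Deriv K s t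
            → _≈_ (alg A) (eval (alg A) ρ s) (eval (alg A) ρ t)
Deriv-sound K A ρ d-refl          = ≈-refl (alg A)
Deriv-sound K A ρ (d-sym d)       = ≈-sym (alg A) (Deriv-sound K A ρ d)
Deriv-sound K A ρ (d-trans d e)   = ≈-trans (alg A) (Deriv-sound K A ρ d) (Deriv-sound K A ρ e)
Deriv-sound K A ρ (d-cong f ds)   = ⟦⟧-cong (alg A) f (λ k → Deriv-sound K A ρ (ds k))
Deriv-sound K A ρ (d-ax a h ds)   =
  ≈-trans B (eval-subst B ρ h (lhs C))
    (≈-trans B (sat A a (λ u → eval B ρ (h u))
                  (λ p → ≈-trans B (≈-sym B (eval-subst B ρ h (lhs (P p))))
                           (≈-trans B (Deriv-sound K A ρ (ds p)) (eval-subst B ρ h (rhs (P p))))))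
      (≈-sym B (eval-subst B ρ h (rhs C))))
  where
    B = alg A
    C = conclusion (axiom K a)
    P = premise (axiom K a)

evalHom : ∀ K {V} (A : Model K) (ρ : V → Carrier (alg A)) → HomM (Tm K V) A
evalHom K A ρ = record { fun = eval (alg A) ρ ; cong = Deriv-sound K A ρ ; hom = λ f as → ≈-refl (alg A) }

termHom : ∀ K {V} → Term (lang K) V → HomM (Tm K ⊤) (Tm K V)
termHom K t = substHom K (λ _ → t)

F₁-substHom-termHom : ∀ {X Y} (F : Functor X Y) {V W} (σ : V → Term (lang X) W) (t : Term (lang X) V)
                    → (F₁ F {Tm X V} {Tm X W} (substHom X σ) ∘ₕ F₁ F {Tm X ⊤} (termHom X t))
                      ≗ₕ F₁ F {Tm X ⊤} (termHom X (t [ σ ]))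
F₁-substHom-termHom {X} F {V} {W} σ t b =
  ≈-trans B (≈-sym B (F-∘ F (substHom X σ) (termHom X t) b))
            (F-cong F (subst-comp X (λ _ → t) σ) b)
  where B = alg (F₀ F (Tm X W))

module Presentation {K : GQV} {κ : Set} (P : Model K) (π : HomM (Tm K κ) P) where

  RespectsKernel : (A : Model K) → (κ → Carrier (alg A)) → Set
  RespectsKernel A ρ = ∀ s t → _≈_ (alg P) (fun π s) (fun π t)
                     → _≈_ (alg A) (eval (alg A) ρ s) (eval (alg A) ρ t)

  hom-respectsKernel : ∀ (B : Model K) (q : HomM P B) → RespectsKernel B (λ i → fun q (fun π (var i)))
  hom-respectsKernel B q s t p =
    ≈-trans (alg B) (≈-sym (alg B) (free-hom-eval (q ∘ₕ π) s))
      (≈-trans (alg B) (cong q p) (free-hom-eval (q ∘ₕ π) t))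

  sat-kernel⇒respectsKernel : ∀ (A : Model K) {W} (g : W → Carrier (alg A)) (σ : κ → Term (lang K) W)
    → (∀ k → Sat (alg A) g (eqn (kernel {B = P} π ⟨ σ ⟩ₑ) k))
    → RespectsKernel A (λ i → eval (alg A) g (σ i))
  sat-kernel⇒respectsKernel A g σ sat s t p =
    ≈-trans (alg A) (≈-sym (alg A) (eval-subst (alg A) g σ s))
      (≈-trans (alg A) (sat ((s ≐ t) , p)) (eval-subst (alg A) g σ t))

  respectsKernel⇒sat-kernel : ∀ (A : Model K) {W} (g : W → Carrier (alg A)) (σ : κ → Term (lang K) W)
    → RespectsKernel A (λ i → eval (alg A) g (σ i))
    → ∀ k → Sat (alg A) g (eqn (kernel {B = P} π ⟨ σ ⟩ₑ) k)
  respectsKernel⇒sat-kernel A g σ resp ((s ≐ t) , p) =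
    ≈-trans (alg A) (eval-subst (alg A) g σ s)
      (≈-trans (alg A) (resp s t p) (≈-sym (alg A) (eval-subst (alg A) g σ t)))

  module _ (surj : ∀ b → Σ[ t ∈ Term (lang K) κ ] _≈_ (alg P) (fun π t) b) where

    private
      section : Carrier (alg P) → Term (lang K) κ
      section b = proj₁ (surj b)

      π-section : ∀ b → _≈_ (alg P) (fun π (section b)) b
      π-section b = proj₂ (surj b)

    lift : (A : Model K) {ρ : κ → Carrier (alg A)} → RespectsKernel A ρ → HomM P A
    lift A {ρ} resp = record
      { fun  = λ b → eval (alg A) ρ (section b)
      ; cong = λ {b} {b'} e → resp _ _ (≈-trans Q (π-section b) (≈-trans Q e (≈-sym Q (π-section b'))))
      ; hom  = λ f bs → resp _ _
          (≈-trans Q (π-section _)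
            (≈-trans Q (⟦⟧-cong Q f (λ k → ≈-sym Q (π-section (bs k))))
              (≈-sym Q (hom π f (λ k → section (bs k)))))) }
      where Q = alg P

    lift-π : (A : Model K) {ρ : κ → Carrier (alg A)} (resp : RespectsKernel A ρ)
           → ∀ t → _≈_ (alg A) (fun (lift A resp) (fun π t)) (eval (alg A) ρ t)
    lift-π A resp t = resp _ t (π-section (fun π t))

    hom-ext : ∀ (B : Model K) (q q' : HomM P B)
            → (∀ i → _≈_ (alg B) (fun q (fun π (var i))) (fun q' (fun π (var i)))) → q ≗ₕ q'
    hom-ext B q q' e b =
      ≈-trans (alg B) (cong q (≈-sym (alg P) (π-section b)))
        (≈-trans (alg B) (free-hom-ext (q ∘ₕ π) (q' ∘ₕ π) e (section b)) (cong q' (π-section b)))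

initial-hom-unique : ∀ {K} (I : Model K) → IsInitial I → ∀ B (q q' : HomM I B) → q ≗ₕ q'
initial-hom-unique I init B q q' b =
  ≈-trans (alg B) (proj₂ (init B) q b) (≈-sym (alg B) (proj₂ (init B) q' b))

module Adjunction {X Y : GQV} {F : Functor X Y} (LA : LeftAdjoint F) where
  open LeftAdjoint LA

  transpose : ∀ A {B} → HomM (F₀ F A) B → HomM A (F₀ G B)
  transpose A q = F₁ G q ∘ₕ η A

  untranspose : ∀ A {B} → HomM A (F₀ G B) → HomM (F₀ F A) B
  untranspose A {B} f = proj₁ (universal A B f)

  transpose-untranspose : ∀ A {B} (f : HomM A (F₀ G B)) → transpose A (untranspose A f) ≗ₕ f
  transpose-untranspose A {B} f = proj₁ (proj₂ (universal A B f))

  transpose-injective : ∀ A {B} (q q' : HomM (F₀ F A) B) → transpose A q ≗ₕ transpose A q' → q ≗ₕ q'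
  transpose-injective A {B} q q' e b =
    ≈-trans (alg B) (unique q e b) (≈-sym (alg B) (unique q' (λ _ → ≈-refl (alg (F₀ G B))) b))
    where unique = proj₂ (proj₂ (universal A B (transpose A q')))

  transpose-∘F₁ : ∀ {A A' B} (q : HomM (F₀ F A') B) (h : HomM A A')
                → transpose A (q ∘ₕ F₁ F {A} {A'} h) ≗ₕ (transpose A' q ∘ₕ h)
  transpose-∘F₁ {A} {A'} {B} q h a =
    ≈-trans (alg (F₀ G B)) (F-∘ G q (F₁ F {A} {A'} h) _) (cong (F₁ G q) (η-natural h a))

  module _ {V : Set} (A : Model Y) (H : HomM (F₀ F (Tm X V)) A) where

    restrict : Term (lang X) V → HomM (F₀ F (Tm X ⊤)) A
    restrict t = H ∘ₕ F₁ F {Tm X ⊤} (termHom X t)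

    transposedVar : V → Carrier (alg (F₀ G A))
    transposedVar v = fun (transpose (Tm X V) H) (var v)

    private
      GA = alg (F₀ G A)
      transpose-restrict : ∀ t → _≈_ GA (fun (transpose (Tm X ⊤) (restrict t)) (var tt))
                                        (eval GA transposedVar t)
      transpose-restrict t = ≈-trans GA (transpose-∘F₁ H (termHom X t) (var tt))
                                        (free-hom-eval (transpose (Tm X V) H) t)

    transpose-sat⇒≗ : ∀ {s t} → Sat GA transposedVar (s ≐ t) → restrict s ≗ₕ restrict t
    transpose-sat⇒≗ {s} {t} e = transpose-injective (Tm X ⊤) (restrict s) (restrict t)
      (free-hom-ext (transpose (Tm X ⊤) (restrict s)) (transpose (Tm X ⊤) (restrict t))
        (λ _ → ≈-trans GA (transpose-restrict s) (≈-trans GA e (≈-sym GA (transpose-restrict t)))))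

    ≗⇒transpose-sat : ∀ {s t} → restrict s ≗ₕ restrict t → Sat GA transposedVar (s ≐ t)
    ≗⇒transpose-sat {s} {t} e =
      ≈-trans GA (≈-sym GA (transpose-restrict s)) (≈-trans GA (F-cong G e _) (transpose-restrict t))

  copair : ∀ {V} {A : Model Y} (h : V → HomM (F₀ F (Tm X ⊤)) A)
         → Σ[ H ∈ HomM (F₀ F (Tm X V)) A ] (∀ j → restrict A H (var j) ≗ₕ h j)
  copair {V} {A} h = H , λ j → transpose-injective (Tm X ⊤) (restrict A H (var j)) (h j)
      (free-hom-ext (transpose (Tm X ⊤) (restrict A H (var j))) (transpose (Tm X ⊤) (h j))
        (λ _ → ≈-trans (alg (F₀ G A)) (transpose-∘F₁ H (termHom X (var j)) (var tt))
                 (transpose-untranspose (Tm X V) k (var j))))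
    where
      k : HomM (Tm X V) (F₀ G A)
      k = evalHom X (F₀ G A) (λ j → fun (transpose (Tm X ⊤) (h j)) (var tt))
      H = untranspose (Tm X V) k

  initial⇒G-indiscrete : IsInitial (F₀ F (Tm X ⊤)) → ∀ B (c c' : Carrier (alg (F₀ G B)))
                       → _≈_ (alg (F₀ G B)) c c'
  initial⇒G-indiscrete init B c c' = begin
    c                                        ≈⟨ transpose-untranspose (Tm X ⊤) (point c) (var tt) ⟨
    fun (transpose (Tm X ⊤) (q c)) (var tt)  ≈⟨ F-cong G (unique (q c) (q c')) _ ⟩
    fun (transpose (Tm X ⊤) (q c')) (var tt) ≈⟨ transpose-untranspose (Tm X ⊤) (point c') (var tt) ⟩
    c'                                       ∎
    where
      open SetoidReasoning (setoid (alg (F₀ G B)))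
      unique = initial-hom-unique (F₀ F (Tm X ⊤)) init B
      point : Carrier (alg (F₀ G B)) → HomM (Tm X ⊤) (F₀ G B)
      point c = evalHom X (F₀ G B) (λ _ → c)
      q : Carrier (alg (F₀ G B)) → HomM (F₀ F (Tm X ⊤)) B
      q c = untranspose (Tm X ⊤) (point c)

  initial⇒trivial : IsInitial (F₀ F (Tm X ⊤)) → Trivial F
  initial⇒trivial init A B =
    untranspose A constant , λ h' → transpose-injective A h' (untranspose A constant) (λ _ → indiscrete _ _)
    where
      indiscrete = initial⇒G-indiscrete init B
      constant : HomM A (F₀ G B)
      constant = record
        { fun  = λ _ → fun (transpose (Tm X ⊤) (proj₁ (init B))) (var tt)
        ; cong = λ _ → ≈-refl (alg (F₀ G B))
        ; hom  = λ _ _ → indiscrete _ _ }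

¬∀⇒∃¬ : ExcludedMiddle (lsuc 0ℓ) → {A : Set} {P : A → Set₁} → ¬ (∀ x → P x) → ∃ λ x → ¬ P x
¬∀⇒∃¬ em ¬∀ = em⇒dne em λ ¬∃ → ¬∀ λ x → em⇒dne em (¬∃⟶∀¬ ¬∃ x)

module Theorem
    (X Y : GQV) (F : Functor X Y) (LA : LeftAdjoint F)
    (κ : Set)
    (π₁ : HomM (Tm Y κ) (F₀ F (Tm X ⊤)))
    (surj : ∀ (b : Carrier (alg (F₀ F (Tm X ⊤)))) →
         Σ[ t ∈ Term (lang Y) κ ] _≈_ (alg (F₀ F (Tm X ⊤))) (fun π₁ t) b)
    (τ : (ψ : Op (lang X)) → HomM (Tm Y κ) (Tm Y (κ × Fin (arity (lang X) ψ))))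
    (τ-spec : ∀ (ψ : Op (lang X)) (t : Term (lang Y) κ) →
         _≈_ (alg (F₀ F (Tm X (Fin (arity (lang X) ψ)))))
             (πₙ F π₁ (Fin (arity (lang X) ψ)) (fun (τ ψ) t))
             (fun (F₁ F (opHom X ψ)) (fun π₁ t))) where

  open Presentation (F₀ F (Tm X ⊤)) π₁
  open Adjunction LA

  Θ : EqSet (lang Y) κ
  Θ = kernel {B = F₀ F (Tm X ⊤)} π₁

  T : Translation X Y κ
  T = translation (λ ψ i → fun (τ ψ) (var i))

  πₙ-τ₊ : ∀ {μ} (t : Term (lang X) μ) (i : κ)
        → _≈_ (alg (F₀ F (Tm X μ))) (πₙ F π₁ μ (τ₊ T t i))
                                    (fun (F₁ F (termHom X t)) (fun π₁ (var i)))
  πₙ-τ₊ {μ} (var j)   i = ≈-refl (alg (F₀ F (Tm X μ)))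
  πₙ-τ₊ {μ} (op ψ ts) i = begin
    eval M ρμ (s [ σ ])                             ≈⟨ eval-subst M ρμ σ s ⟩
    eval M (λ v → eval M ρμ (σ v)) s                ≈⟨ eval-cong M πₙ-σ s ⟩
    eval M (λ v → fun S (πₙ F π₁ n (var v))) s      ≈⟨ hom-eval S _ s ⟨
    fun S (πₙ F π₁ n s)                             ≈⟨ cong S (τ-spec ψ (var i)) ⟩
    fun S (fun (F₁ F (opHom X ψ)) (fun π₁ (var i))) ≈⟨ F₁-substHom-termHom F ts (op ψ var) _ ⟩
    fun (F₁ F (termHom X (op ψ ts))) (fun π₁ (var i)) ∎
    where
      M = alg (F₀ F (Tm X μ))
      open SetoidReasoning (setoid M)
      n = Fin (arity (lang X) ψ)
      ρμ = λ { (i' , j) → fun (F₁ F (ιHom X j)) (fun π₁ (var i')) }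
      s = fun (τ ψ) (var i)
      σ : κ × n → Term (lang Y) (κ × μ)
      σ (i' , m) = τ₊ T (ts m) i'
      S = F₁ F (substHom X ts)
      πₙ-σ : ∀ v → _≈_ M (eval M ρμ (σ v)) (fun S (πₙ F π₁ n (var v)))
      πₙ-σ (i' , m) = ≈-trans M (πₙ-τ₊ (ts m) i') (≈-sym M (F₁-substHom-termHom F ts (var m) _))

  columns-respectKernel : ∀ (A : Model Y) {μ} (g : κ × μ → Carrier (alg A))
    → (∀ k → Sat (alg A) g (eqn (⋃ₑ μ (Θat Θ)) k))
    → ∀ j → RespectsKernel A (λ i → g (i , j))
  columns-respectKernel A g sat j =
    sat-kernel⇒respectsKernel A g (λ i → var (i , j)) (λ k → sat (j , k))

  module Interpretation (A : Model Y) {μ : Set} (g : κ × μ → Carrier (alg A))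
                        (resp : ∀ j → RespectsKernel A (λ i → g (i , j))) where

    private
      AA = alg A
      copair-lifts = copair {μ} {A} (λ j → lift surj A (resp j))

    H : HomM (F₀ F (Tm X μ)) A
    H = proj₁ copair-lifts

    H-πₙ : ∀ t → _≈_ AA (fun H (πₙ F π₁ μ t)) (eval AA g t)
    H-πₙ t = ≈-trans AA (hom-eval H _ t) (eval-cong AA H-generator t)
      where
        H-generator : ∀ v → _≈_ AA (fun H (πₙ F π₁ μ (var v))) (g v)
        H-generator (i , j) =
          ≈-trans AA (proj₂ copair-lifts j (fun π₁ (var i))) (lift-π surj A (resp j) (var i))

    eval-τ₊ : ∀ t i → _≈_ AA (eval AA g (τ₊ T t i)) (fun (restrict A H t) (fun π₁ (var i)))
    eval-τ₊ t i = ≈-trans AA (≈-sym AA (H-πₙ (τ₊ T t i))) (cong H (πₙ-τ₊ t i))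

  preserves : ∀ (μ : Set) (Φ : EqSet (lang X) μ) (e : Eqn (lang X) μ)
            → Ent X Φ e
            → Entₛ Y (τ* T Φ ∪ₑ ⋃ₑ μ (Θat Θ)) (τ*₁ T e)
  preserves μ Φ (l ≐ r) Φ⊨e i A g sat = begin
    eval AA g (τ₊ T l i)                  ≈⟨ eval-τ₊ l i ⟩
    fun (restrict A H l) (fun π₁ (var i)) ≈⟨ H-l≗H-r _ ⟩
    fun (restrict A H r) (fun π₁ (var i)) ≈⟨ eval-τ₊ r i ⟨
    eval AA g (τ₊ T r i)                  ∎
    where
      AA = alg A
      GA = F₀ (LeftAdjoint.G LA) A
      open SetoidReasoning (setoid AA)
      open Interpretation A g (columns-respectKernel A g (λ k → sat (inj₂ k)))
      sat-Φ : ∀ k → Sat (alg GA) (transposedVar A H) (eqn Φ k)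
      sat-Φ k = ≗⇒transpose-sat A H
        (hom-ext surj A (restrict A H (lhs (eqn Φ k))) (restrict A H (rhs (eqn Φ k))) λ i' →
          ≈-trans AA (≈-sym AA (eval-τ₊ _ i')) (≈-trans AA (sat (inj₁ (k , i'))) (eval-τ₊ _ i')))
      H-l≗H-r : restrict A H l ≗ₕ restrict A H r
      H-l≗H-r = transpose-sat⇒≗ A H (Φ⊨e GA (transposedVar A H) sat-Φ)

  closed : ∀ (ψ : Op (lang X))
         → Entₛ Y (⋃ₑ (Fin (arity (lang X) ψ)) (Θat Θ)) (Θ ⟨ τ₊ T (op ψ var) ⟩ₑ)
  closed ψ k A g sat =
    respectsKernel⇒sat-kernel A g (τ₊ T (op ψ var))
      (λ s t p → ≈-trans AA (eval-cong AA (λ i → eval-τ₊ (op ψ var) i) s)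
                   (≈-trans AA (hom-respectsKernel A (restrict A H (op ψ var)) s t p)
                     (≈-sym AA (eval-cong AA (λ i → eval-τ₊ (op ψ var) i) t))))
      k
    where
      AA = alg A
      open Interpretation A g (columns-respectKernel A g sat)

  Θx∪Θy : EqSet (lang Y) (κ ⊎ κ)
  Θx∪Θy = (Θ ⟨ (λ i → var (inj₁ i)) ⟩ₑ) ∪ₑ (Θ ⟨ (λ i → var (inj₂ i)) ⟩ₑ)

  Θ-identifies⇒hom-unique : (∀ i₀ → Ent Y Θx∪Θy (var (inj₁ i₀) ≐ var (inj₂ i₀)))
    → ∀ (B : Model Y) (q q' : HomM (F₀ F (Tm X ⊤)) B) → q ≗ₕ q'
  Θ-identifies⇒hom-unique Θ⊨x≈y B q q' = hom-ext surj B q q' λ i → Θ⊨x≈y i B g sat-Θx∪Θy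
    where
      g : κ ⊎ κ → Carrier (alg B)
      g (inj₁ i) = fun q (fun π₁ (var i))
      g (inj₂ i) = fun q' (fun π₁ (var i))
      sat-Θx∪Θy : ∀ k → Sat (alg B) g (eqn Θx∪Θy k)
      sat-Θx∪Θy (inj₁ k) =
        respectsKernel⇒sat-kernel B g (λ i → var (inj₁ i)) (hom-respectsKernel B q) k
      sat-Θx∪Θy (inj₂ k) =
        respectsKernel⇒sat-kernel B g (λ i → var (inj₂ i)) (hom-respectsKernel B q') k

  Θ-identifies⇒initial : (φ : κ → Term (lang Y) ⊥) → Entₛ Y ∅ₑ (Θ ⟨ φ ⟩ₑ)
    → (∀ i₀ → Ent Y Θx∪Θy (var (inj₁ i₀) ≐ var (inj₂ i₀)))
    → IsInitial (F₀ F (Tm X ⊤))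
  Θ-identifies⇒initial φ ⊨Θφ Θ⊨x≈y B = h , λ h' → Θ-identifies⇒hom-unique Θ⊨x≈y B h' h
    where
      h = lift surj B (sat-kernel⇒respectsKernel B (λ ()) φ (λ k → ⊨Θφ k B (λ ()) (λ ())))

  nonTrivial : ExcludedMiddle (lsuc 0ℓ) → NonTrivial F → NonTrivialCT Y κ Θ
  nonTrivial em F-nonTrivial φ ⊨Θφ =
    ¬∀⇒∃¬ em λ Θ⊨x≈y → F-nonTrivial (initial⇒trivial (Θ-identifies⇒initial φ ⊨Θφ Θ⊨x≈y))

theorem4p3 : ExcludedMiddle (lsuc 0ℓ) →
    ∀ (X Y : GQV) (F : Functor X Y) → LeftAdjoint F → NonTrivial F →
    ∀ (κ : Set) → κ →
    ∀ (π₁ : HomM (Tm Y κ) (F₀ F (Tm X ⊤))) →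
      (∀ (b : Carrier (alg (F₀ F (Tm X ⊤)))) →
         Σ[ t ∈ Term (lang Y) κ ] _≈_ (alg (F₀ F (Tm X ⊤))) (fun π₁ t) b) →
    ∀ (τ : (ψ : Op (lang X)) → HomM (Tm Y κ) (Tm Y (κ × Fin (arity (lang X) ψ)))) →
      (∀ (ψ : Op (lang X)) (t : Term (lang Y) κ) →
         _≈_ (alg (F₀ F (Tm X (Fin (arity (lang X) ψ)))))
             (πₙ F π₁ (Fin (arity (lang X) ψ)) (fun (τ ψ) t))
             (fun (F₁ F (opHom X ψ)) (fun π₁ t))) →
    ContextualTranslation X Y κ (translation (λ ψ i → fun (τ ψ) (var i))) (kernel {B = F₀ F (Tm X ⊤)} π₁)
      × NonTrivialCT Y κ (kernel {B = F₀ F (Tm X ⊤)} π₁)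
theorem4p3 em X Y F LA F-nonTrivial κ _ π₁ surj τ τ-spec =
  record { preserves = preserves ; closed = closed } , nonTrivial em F-nonTrivial
  where open Theorem X Y F LA κ π₁ surj τ τ-spec
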